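{- Let $\mathcal U\subseteq(\omega)^\omega$ be a partition-ultrafilter. Then player I has a winning strategy in the game $G(\mathcal U)$ if and only if $\mathcal U$ is not relatively happy.
   Context: A partition of a set $S$ is a set of pairwise disjoint nonempty subsets (blocks) with union $S$. $(\omega)$ is the set of all partitions of $\omega$, $(\omega)^\omega$ those with infinitely many blocks, $\{\omega\}$ the one-block partition. For partitions $X,Y$ of the same set, $X\sqsubseteq Y$ means every block of $X$ is a union of blocks of $Y$; $X\sqcap Y$ is the finest partition coarser than both. For $n\in\omega$ and a partition $X$ (of $\omega$ or of a natural number), $X\sqcap\{n\}$ denotes the partition obtained from $X$ by merging into a single block all blocks of $X$ containing an element of $n=\{0,\dots,n-1\}$. $X\sqsubseteq^*Y$ means $(X\sqcap\{n\})\sqsubseteq Y$ for some $n$. A partition-filter is $\mathcal F\subseteq(\omega)$ with (a) $\{\omega\}\notin\mathcal F$; (b) $X,Y\in\mathcal F\Rightarrow X\sqcap Y\in\mathcal F$; (c) $X\in\mathcal F$, $X\sqsubseteq Y\in(\omega)$ $\Rightarrow Y\in\mathcal F$. A partition-ultrafilter is a partition-filter not properly contained in any partition-filter. A segment is a partition $s$ of a natural number $n=\{0,\dots,n-1\}$; $\mathrm{dom}(s)=n$, $|s|$ = number of blocks, $s^*:=s\cup\{\{\mathrm{dom}(s)\}\}$. For a segment $s$ and a partition $X$ of $\omega$ (or a segment $X$ with larger domain): $s\sqsubseteq X$ means each block of $s$ is a union of sets $b\cap\mathrm{dom}(s)$, $b\in X$; $s\trianglelefteq X$ means each block of $s$ equals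 $d\cap\mathrm{dom}(s)$ for some $d\in X$. For $\mathcal B\subseteq(\omega)^\omega$, $\mathrm{fil}(\mathcal B)$ is the set of $X\in(\omega)$ with $(Y_0\sqcap\dots\sqcap Y_n)\sqsubseteq^*X$ for some finitely many $Y_0,\dots,Y_n\in\mathcal B$. A partition $X$ diagonalizes a family $\{X_s:s\text{ a segment}\}$ if $X\sqsubseteq X_\emptyset$ and for every segment $s$ with $s^*\trianglelefteq X$, $(X\sqcap\{\mathrm{dom}(s)+1\})\sqsubseteq X_s$. A family $\mathcal A\subseteq(\omega)^\omega$ is relatively happy if whenever $\mathrm{fil}\{X_s:s\text{ a segment}\}\subseteq\mathcal A$ there is $X\in\mathcal A$ diagonalizing $\{X_s\}$. The game $G(\mathcal U)$: players I and II alternate for $n=1,2,3,\dots$; on move $n$ player I plays $X_n\in\mathcal U$, and player II answers with a segment $s_n$ such that $|s_n|=n$, $s_{n-1}^*\trianglelefteq s_n$, and for all $m<n$, $(s_n^*\sqcap\{\mathrm{dom}(s_m)+1\})\sqsubseteq X_{m+1}$, where $s_0:=\emptyset$. Player I wins iff the unique partition $X$ of $\omega$ with $s_n\trianglelefteq X$ for all $n$ is not in $\mathcal U$. -}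

module Defs where

open import Level using (0ℓ)
open import Data.Nat using (ℕ; zero; suc; _+_; _≤_; _<_; _<ᵇ_)
open import Data.Nat.Properties using (_≟_)
open import Data.Bool using (if_then_else_)
open import Data.Fin using (Fin; toℕ)
open import Data.Vec using (Vec; []; _∷_; _∷ʳ_; tabulate)
open import Data.List using (List; []; _∷_; length; filter; upTo; map)
open import Data.List.Membership.Propositional using (_∈_)
open import Data.Product using (Σ; Σ-syntax; ∃; _×_; _,_; proj₁; proj₂)
open import Relation.Nullary using (¬_)
open import Relation.Binary.PropositionalEquality using (_≡_)
open import Function.Bundles using (_⇔_)

-- A partition X of ω is represented by the map  rep : ℕ → ℕ  sending each
-- n to the least element of the block of X containing n.  Conversely any
-- such map with  rep n ≤ n  and  rep (rep n) ≡ rep n  determines the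
-- partition whose blocks are the fibres of rep (and rep n is then the
-- minimum of the block of n).  This is a bijective encoding of (ω)
-- (up to pointwise equality of rep).

record Partition : Set where
  field
    rep      : ℕ → ℕ
    rep-≤    : ∀ n → rep n ≤ n
    rep-idem : ∀ n → rep (rep n) ≡ rep n
open Partition public

Same : Partition → ℕ → ℕ → Set
Same X a b = rep X a ≡ rep X b

-- R₁ ≼ R₂ : (the partition given by) R₁ is coarser than R₂, i.e. every
-- block of R₁ is a union of blocks of R₂.
_≼_ : (ℕ → ℕ) → (ℕ → ℕ) → Set
R₁ ≼ R₂ = ∀ a b → R₂ a ≡ R₂ b → R₁ a ≡ R₁ b

_⊑_ : Partition → Partition → Set
X ⊑ Y = rep X ≼ rep Y

IsOneBlock : Partition → Set
IsOneBlock X = ∀ a b → Same X a b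

-- X ∈ (ω)^ω : infinitely many blocks (infinitely many block-minima)
Infinite : Partition → Set
Infinite X = ∀ k → Σ[ n ∈ ℕ ] (k ≤ n × rep X n ≡ n)

IsMeet : Partition → Partition → Partition → Set
IsMeet X Y Z = Z ⊑ X × Z ⊑ Y × (∀ W → W ⊑ X → W ⊑ Y → W ⊑ Z)

IsMeetL : List Partition → Partition → Set
IsMeetL Ys Z = (∀ Y → Y ∈ Ys → Z ⊑ Y) × (∀ W → (∀ Y → Y ∈ Ys → W ⊑ Y) → W ⊑ Z)

-- X ⊓ {n}, on block-minimum maps: merge all blocks meeting n = {0..n-1}
-- (a block meets n iff its minimum is < n; the merged block has minimum 0).
mergeRep : (ℕ → ℕ) → ℕ → (ℕ → ℕ)
mergeRep R n a = if R a <ᵇ n then 0 else R a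

_⊑*_ : Partition → Partition → Set
X ⊑* Y = Σ[ n ∈ ℕ ] (mergeRep (rep X) n ≼ rep Y)

IsPFilter : (Partition → Set) → Set
IsPFilter F =
    (∀ X → F X → ¬ IsOneBlock X)
  × (∀ X Y Z → F X → F Y → IsMeet X Y Z → F Z)
  × (∀ X Y → F X → X ⊑ Y → F Y)

IsPUltrafilter : (Partition → Set) → Set₁
IsPUltrafilter U =
  IsPFilter U × (∀ (G : Partition → Set) → IsPFilter G → (∀ X → U X → G X) → ∀ X → G X → U X)

-- Segments.  A segment with domain n is given by the vector of
-- block-minima (v[a] = least element of the block of a, for a < n).

nth : ∀ {n} → Vec ℕ n → ℕ → ℕ
nth []      _       = 0
nth (x ∷ v) zero    = x
nth (x ∷ v) (suc a) = nth v a

Seg : Set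
Seg = Σ ℕ (Vec ℕ)

dom : Seg → ℕ
dom = proj₁

segRep : Seg → ℕ → ℕ
segRep (n , v) = nth v

ValidSeg : Seg → Set
ValidSeg s = ∀ a → a < dom s → segRep s a ≤ a × segRep s (segRep s a) ≡ segRep s a

emptySeg : Seg
emptySeg = (0 , [])

-- s* = s ∪ {{dom s}}
star : Seg → Seg
star (n , v) = (suc n , v ∷ʳ n)

numBlocks : Seg → ℕ
numBlocks (n , v) = length (filter (λ a → nth v a ≟ a) (upTo n))

-- s ⊑ X, for a segment given as (domain n, block-minimum map r) and X
-- given by its block-minimum map R (a partition of ω or a segment of
-- larger domain): each block of s is a union of sets b ∩ n, b ∈ X.
SegLE : ℕ → (ℕ → ℕ) → (ℕ → ℕ) → Set
SegLE n r R = ∀ a b → a < n → b < n → R a ≡ R b → r a ≡ r b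

-- s ⊴ X : each block of s equals d ∩ n for some block d of X
-- (d is named by its minimum).
SegTri : ℕ → (ℕ → ℕ) → (ℕ → ℕ) → Set
SegTri n r R = ∀ a → a < n → Σ[ d ∈ ℕ ] (∀ b → b < n → (r b ≡ r a) ⇔ (R b ≡ d))

_⊴ω_ : Seg → Partition → Set
s ⊴ω X = SegTri (dom s) (segRep s) (rep X)

_⊴s_ : Seg → Seg → Set
s ⊴s t = dom s ≤ dom t × SegTri (dom s) (segRep s) (segRep t)

Fil : (Seg → Partition) → Partition → Set
Fil Xf X =
  Σ[ ss ∈ List Seg ] ((ss ≡ [] → Data.Empty.⊥) × (∀ s → s ∈ ss → ValidSeg s)
    × Σ[ Z ∈ Partition ] (IsMeetL (map Xf ss) Z × Z ⊑* X))
  where import Data.Empty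

Diagonalizes : Partition → (Seg → Partition) → Set
Diagonalizes X Xf =
  X ⊑ Xf emptySeg
  × (∀ s → ValidSeg s → star s ⊴ω X → mergeRep (rep X) (dom s + 1) ≼ rep (Xf s))

RelHappy : (Partition → Set) → Set
RelHappy A =
  ∀ (Xf : Seg → Partition) → (∀ X → Fil Xf X → A X) → Σ[ X ∈ Partition ] (A X × Diagonalizes X Xf)

-- a strategy for player I: given II's moves s₁ … s_k, play X_{k+1}
Strategy : Set
Strategy = (k : ℕ) → Vec Seg k → Partition

prefix : (ℕ → Seg) → (k : ℕ) → Vec Seg k
prefix s k = tabulate (λ (i : Fin k) → s (suc (toℕ i)))

moveI : Strategy → (ℕ → Seg) → ℕ → Partition
moveI σ s m = σ m (prefix s m)

LegalII : Strategy → (ℕ → Seg) → ℕ → Set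
LegalII σ s k =
    ValidSeg (s (suc k))
  × numBlocks (s (suc k)) ≡ suc k
  × star (s k) ⊴s s (suc k)
  × (∀ m → m < suc k →
       SegLE (dom (s (suc k)) + 1)
             (mergeRep (segRep (star (s (suc k)))) (dom (s m) + 1))
             (rep (moveI σ s m)))

IWins : (Partition → Set) → Set
IWins U =
  Σ[ σ ∈ Strategy ]
    ((∀ k h → U (σ k h))
    × (∀ (s : ℕ → Seg) → s 0 ≡ emptySeg → (∀ k → LegalII σ s k) →
         ∀ X → (∀ n → s n ⊴ω X) → ¬ U X))

module Submission where

-- A position of G(U) is determined by II's last segment t: the earlier segments are the
-- restrictions of t below its block minima, since every legal answer adds exactly one block
-- minimum.  So strategies of I amount to families {X_t}.  If fil{X_t} ⊆ U has no diagonalizer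
-- in U, I plays X_t after t; legality makes the outcome X of any play satisfy
-- X ⊓ {dom t + 1} ⊑ X_t whenever t* ⊴ X, i.e. X diagonalizes {X_t}, so X ∉ U.  Conversely the
-- moves {X_t} of a winning strategy lie in U, hence so does fil{X_t}: U is closed under finite
-- meets and, being maximal and made of infinite partitions, under ⊑*.  A diagonalizer X ∈ U
-- would let II answer with the restrictions of X below its block minima, a legal play whose
-- outcome X lies in U.

open import Defs
open import Level using (0ℓ)
open import Axiom.ExcludedMiddle using (ExcludedMiddle)
open import Relation.Nullary using (¬_; yes; no; _×-dec_)
open import Function.Bundles using (_⇔_; mk⇔; Equivalence)
open import Function.Base using (_∘_)
open import Data.Bool using (true; false; T; if_then_else_)
open import Data.Nat using (ℕ; zero; suc; _+_; _∸_; _≤_; _<_; z≤n; s≤s; _<ᵇ_; _<?_)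
open import Data.Nat.Properties
open import Data.Fin using (toℕ)
open import Data.Fin.Properties using (toℕ<n)
open import Data.Vec using (Vec; []; _∷_; _∷ʳ_; tabulate)
open import Data.Vec.Properties using (tabulate-cong)
open import Data.List using ([]; _∷_; [_]; _++_; length; filter; upTo; map)
open import Data.List.Properties using (upTo-∷ʳ; filter-++; filter-accept; filter-reject; length-++)
open import Data.List.Membership.Propositional using (_∈_)
open import Data.List.Membership.Propositional.Properties using (∈-map⁻)
open import Data.List.Relation.Unary.Any using (here; there)
open import Data.Product using (Σ-syntax; _×_; _,_; proj₁; proj₂)
open import Data.Sum using (_⊎_; inj₁; inj₂; [_,_]′)
open import Data.Empty using (⊥-elim)
open import Relation.Unary using (Decidable)
open import Relation.Binary using (tri<; tri≈; tri>)
open import Relation.Binary.PropositionalEquality using (_≡_; _≢_; refl; sym; trans; cong; cong₂; subst; module ≡-Reasoning)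

RepBelow : ℕ → (ℕ → ℕ) → Set
RepBelow n r = ∀ a → a < n → r a ≤ a × r (r a) ≡ r a

rep-RepBelow : ∀ X n → RepBelow n (rep X)
rep-RepBelow X n a _ = rep-≤ X a , rep-idem X a

RepBelow-≤ : ∀ {m n r} → m ≤ n → RepBelow n r → RepBelow m r
RepBelow-≤ m≤n R a a<m = R a (<-≤-trans a<m m≤n)

-- Below n, r a and R a are both the least element of the common block of a.
SegTri⇒agree : ∀ {n r R} → RepBelow n r → RepBelow n R → SegTri n r R → ∀ a → a < n → r a ≡ R a
SegTri⇒agree {n} {r} {R} vr vR T a a<n = ≤-antisym ra≤Ra Ra≤ra
  where
  d : ℕ
  d = proj₁ (T a a<n)
  block : ∀ b → b < n → r b ≡ r a ⇔ R b ≡ d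
  block = proj₂ (T a a<n)
  ra<n : r a < n
  ra<n = ≤-<-trans (proj₁ (vr a a<n)) a<n
  Ra<n : R a < n
  Ra<n = ≤-<-trans (proj₁ (vR a a<n)) a<n
  Ra≡d : R a ≡ d
  Ra≡d = Equivalence.to (block a a<n) refl
  r[Ra]≡ra : r (R a) ≡ r a
  r[Ra]≡ra = Equivalence.from (block (R a) Ra<n) (trans (proj₂ (vR a a<n)) Ra≡d)
  R[ra]≡Ra : R (r a) ≡ R a
  R[ra]≡Ra = trans (Equivalence.to (block (r a) ra<n) (proj₂ (vr a a<n))) (sym Ra≡d)
  ra≤Ra : r a ≤ R a
  ra≤Ra = subst (_≤ R a) r[Ra]≡ra (proj₁ (vr (R a) Ra<n))
  Ra≤ra : R a ≤ r a
  Ra≤ra = subst (_≤ r a) R[ra]≡Ra (proj₁ (vR (r a) ra<n))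

agree⇒RepBelow : ∀ {n r} R → RepBelow n R → (∀ a → a < n → r a ≡ R a) → RepBelow n r
agree⇒RepBelow {n} {r} R vR r≡R a a<n =
  subst (_≤ a) (sym (r≡R a a<n)) (proj₁ (vR a a<n)) ,
  (begin
    r (r a) ≡⟨ cong r (r≡R a a<n) ⟩
    r (R a) ≡⟨ r≡R (R a) (≤-<-trans (proj₁ (vR a a<n)) a<n) ⟩
    R (R a) ≡⟨ proj₂ (vR a a<n) ⟩
    R a     ≡⟨ sym (r≡R a a<n) ⟩
    r a     ∎)
  where open ≡-Reasoning

agree⇒SegTri : ∀ {n r R} (f : ℕ → ℕ) → (∀ a → a < n → r a ≡ f a) → (∀ a → a < n → R a ≡ f a) →
               SegTri n r R
agree⇒SegTri f r≡f R≡f a a<n = f a , λ b b<n →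
  mk⇔ (λ e → trans (R≡f b b<n) (trans (sym (r≡f b b<n)) (trans e (r≡f a a<n))))
      (λ e → trans (r≡f b b<n) (trans (sym (R≡f b b<n)) (trans e (sym (r≡f a a<n)))))

nth-∷ʳ : ∀ {n} (v : Vec ℕ n) x a → a < n → nth (v ∷ʳ x) a ≡ nth v a
nth-∷ʳ (y ∷ v) x zero    _         = refl
nth-∷ʳ (y ∷ v) x (suc a) (s≤s a<n) = nth-∷ʳ v x a a<n

nth-∷ʳ-last : ∀ {n} (v : Vec ℕ n) x → nth (v ∷ʳ x) n ≡ x
nth-∷ʳ-last []      x = refl
nth-∷ʳ-last (y ∷ v) x = nth-∷ʳ-last v x

nth-tabulate : ∀ n (f : ℕ → ℕ) a → a < n → nth (tabulate {n = n} (λ i → f (toℕ i))) a ≡ f a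
nth-tabulate (suc n) f zero    _         = refl
nth-tabulate (suc n) f (suc a) (s≤s a<n) = nth-tabulate n (f ∘ suc) a a<n

nth-ext : ∀ {n} (v w : Vec ℕ n) → (∀ a → a < n → nth v a ≡ nth w a) → v ≡ w
nth-ext []      []      _ = refl
nth-ext (x ∷ v) (y ∷ w) E = cong₂ _∷_ (E 0 (s≤s z≤n)) (nth-ext v w (λ a a<n → E (suc a) (s≤s a<n)))

seg-ext : ∀ s t → dom s ≡ dom t → (∀ a → a < dom s → segRep s a ≡ segRep t a) → s ≡ t
seg-ext (n , v) (.n , w) refl E = cong (n ,_) (nth-ext v w E)

emptySeg-valid : ValidSeg emptySeg
emptySeg-valid a ()

star-agree : ∀ s a → a < dom s → segRep (star s) a ≡ segRep s a
star-agree (n , v) = nth-∷ʳ v n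

star-last : ∀ s → segRep (star s) (dom s) ≡ dom s
star-last (n , v) = nth-∷ʳ-last v n

star-valid : ∀ s → ValidSeg s → ValidSeg (star s)
star-valid s V a a<1+n with m<1+n⇒m<n∨m≡n a<1+n
... | inj₁ a<n = agree⇒RepBelow (segRep s) V (star-agree s) a a<n
... | inj₂ refl = ≤-reflexive (star-last s) , cong (segRep (star s)) (star-last s)

star⊴ω⇒agree : ∀ t {X} → ValidSeg t → star t ⊴ω X →
               ∀ a → a < suc (dom t) → segRep (star t) a ≡ rep X a
star⊴ω⇒agree t {X} t-valid = SegTri⇒agree (star-valid t t-valid) (rep-RepBelow X _)

star-agree-with : ∀ s (f : ℕ → ℕ) → (∀ a → a < dom s → segRep s a ≡ f a) → f (dom s) ≡ dom s →
                  ∀ a → a < suc (dom s) → segRep (star s) a ≡ f a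
star-agree-with s f s≡f f-last a a<1+n with m<1+n⇒m<n∨m≡n a<1+n
... | inj₁ a<n  = trans (star-agree s a a<n) (s≡f a a<n)
... | inj₂ refl = trans (star-last s) (sym f-last)

minimum? : (r : ℕ → ℕ) → Decidable (λ a → r a ≡ a)
minimum? r a = r a ≟ a

countMinima : (ℕ → ℕ) → ℕ → ℕ
countMinima r n = length (filter (minimum? r) (upTo n))

countMinima-suc : ∀ r n →
  countMinima r (suc n) ≡ countMinima r n + length (filter (minimum? r) [ n ])
countMinima-suc r n = begin
  length (filter P? (upTo (suc n)))              ≡⟨ cong (length ∘ filter P?) (sym (upTo-∷ʳ n)) ⟩
  length (filter P? (upTo n ++ [ n ]))           ≡⟨ cong length (filter-++ P? (upTo n) [ n ]) ⟩
  length (filter P? (upTo n) ++ filter P? [ n ]) ≡⟨ length-++ (filter P? (upTo n)) ⟩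
  countMinima r n + length (filter P? [ n ])     ∎
  where
  open ≡-Reasoning
  P? : Decidable (λ a → r a ≡ a)
  P? = minimum? r

countMinima-suc-minimum : ∀ r n → r n ≡ n → countMinima r (suc n) ≡ suc (countMinima r n)
countMinima-suc-minimum r n rn≡n = begin
  countMinima r (suc n)                                ≡⟨ countMinima-suc r n ⟩
  countMinima r n + length (filter (minimum? r) [ n ]) ≡⟨ cong (λ l → countMinima r n + length l)
                                                            (filter-accept (minimum? r) rn≡n) ⟩
  countMinima r n + 1                                  ≡⟨ +-comm (countMinima r n) 1 ⟩
  suc (countMinima r n)                                ∎
  where open ≡-Reasoning

countMinima-suc-nonminimum : ∀ r n → r n ≢ n → countMinima r (suc n) ≡ countMinima r n
countMinima-suc-nonminimum r n rn≢n = begin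
  countMinima r (suc n)                                ≡⟨ countMinima-suc r n ⟩
  countMinima r n + length (filter (minimum? r) [ n ]) ≡⟨ cong (λ l → countMinima r n + length l)
                                                            (filter-reject (minimum? r) rn≢n) ⟩
  countMinima r n + 0                                  ≡⟨ +-identityʳ (countMinima r n) ⟩
  countMinima r n                                      ∎
  where open ≡-Reasoning

countMinima-cong : ∀ r R n → (∀ a → a < n → r a ≡ R a) → countMinima r n ≡ countMinima R n
countMinima-cong r R zero    _   = refl
countMinima-cong r R (suc n) r≡R with r n ≟ n
... | yes rn≡n = begin
  countMinima r (suc n) ≡⟨ countMinima-suc-minimum r n rn≡n ⟩
  suc (countMinima r n) ≡⟨ cong suc (countMinima-cong r R n (λ a a<n → r≡R a (m<n⇒m<1+n a<n))) ⟩
  suc (countMinima R n) ≡⟨ sym (countMinima-suc-minimum R n (trans (sym (r≡R n (n<1+n n))) rn≡n)) ⟩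
  countMinima R (suc n) ∎
  where open ≡-Reasoning
... | no rn≢n = begin
  countMinima r (suc n) ≡⟨ countMinima-suc-nonminimum r n rn≢n ⟩
  countMinima r n       ≡⟨ countMinima-cong r R n (λ a a<n → r≡R a (m<n⇒m<1+n a<n)) ⟩
  countMinima R n       ≡⟨ sym (countMinima-suc-nonminimum R n (rn≢n ∘ trans (r≡R n (n<1+n n)))) ⟩
  countMinima R (suc n) ∎
  where open ≡-Reasoning

countMinima-≤-suc : ∀ r n → countMinima r n ≤ countMinima r (suc n)
countMinima-≤-suc r n = subst (countMinima r n ≤_) (sym (countMinima-suc r n)) (m≤m+n _ _)

countMinima-mono : ∀ r {m n} → m ≤ n → countMinima r m ≤ countMinima r n
countMinima-mono r {m} {zero}  m≤0 rewrite n≤0⇒n≡0 m≤0 = ≤-refl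
countMinima-mono r {m} {suc n} m≤1+n with m≤n⇒m<n∨m≡n m≤1+n
... | inj₁ m<1+n = ≤-trans (countMinima-mono r (≤-pred m<1+n)) (countMinima-≤-suc r n)
... | inj₂ refl  = ≤-refl

countMinima-no-minima : ∀ r lo d → (∀ x → lo ≤ x → x < d + lo → r x ≢ x) →
                        countMinima r (d + lo) ≡ countMinima r lo
countMinima-no-minima r lo zero    _    = refl
countMinima-no-minima r lo (suc d) none =
  trans (countMinima-suc-nonminimum r (d + lo) (none (d + lo) (m≤n+m lo d) (n<1+n _)))
        (countMinima-no-minima r lo d (λ x lo≤x x<d+lo → none x lo≤x (m<n⇒m<1+n x<d+lo)))

-- Positions of the game: a segment determines its history

-- Below dom a + 1, c already has the j + 1 block minima of a*, so none is left for (dom a, dom c).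
no-minimum-beyond : ∀ {a c j} → ValidSeg a → ValidSeg c → star a ⊴s c →
                    numBlocks a ≡ j → numBlocks c ≡ suc j →
                    ∀ x → dom a < x → x < dom c → segRep c x ≢ x
no-minimum-beyond {a} {c} {j} Va Vc (a<c , a⊴c) #a #c x a<x x<c cx≡x = 1+n≰n too-many
  where
  rc : ℕ → ℕ
  rc = segRep c
  a-agree : ∀ y → y < suc (dom a) → segRep (star a) y ≡ rc y
  a-agree = SegTri⇒agree (star-valid a Va) (RepBelow-≤ a<c Vc) a⊴c
  upto-a : countMinima rc (suc (dom a)) ≡ suc j
  upto-a = begin
    countMinima rc (suc (dom a))  ≡⟨ countMinima-suc-minimum rc (dom a)
                                       (trans (sym (a-agree (dom a) (n<1+n _))) (star-last a)) ⟩
    suc (countMinima rc (dom a))  ≡⟨ cong suc (countMinima-cong rc (segRep a) (dom a)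
                                       (λ y y<a → trans (sym (a-agree y (m<n⇒m<1+n y<a))) (star-agree a y y<a))) ⟩
    suc (numBlocks a)             ≡⟨ cong suc #a ⟩
    suc j                         ∎
    where open ≡-Reasoning
  too-many : suc (suc j) ≤ suc j
  too-many = begin
    suc (suc j)                        ≡⟨ cong suc (sym upto-a) ⟩
    suc (countMinima rc (suc (dom a))) ≤⟨ s≤s (countMinima-mono rc a<x) ⟩
    suc (countMinima rc x)             ≡⟨ sym (countMinima-suc-minimum rc x cx≡x) ⟩
    countMinima rc (suc x)             ≤⟨ countMinima-mono rc x<c ⟩
    countMinima rc (dom c)             ≡⟨ #c ⟩
    suc j                              ∎
    where open ≤-Reasoning

predecessor-unique : ∀ {a b c j} → ValidSeg a → ValidSeg b → ValidSeg c → star a ⊴s c → star b ⊴s c →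
                     numBlocks a ≡ j → numBlocks b ≡ j → numBlocks c ≡ suc j → a ≡ b
predecessor-unique {a} {b} {c} Va Vb Vc a⊴c@(a≤c , a⊴c′) b⊴c@(b≤c , b⊴c′) #a #b #c =
  seg-ext a b same-dom same-rep
  where
  Agree : Seg → Set
  Agree t = ∀ y → y < suc (dom t) → segRep (star t) y ≡ segRep c y
  a-agree : Agree a
  a-agree = SegTri⇒agree (star-valid a Va) (RepBelow-≤ a≤c Vc) a⊴c′
  b-agree : Agree b
  b-agree = SegTri⇒agree (star-valid b Vb) (RepBelow-≤ b≤c Vc) b⊴c′
  minimum-at : ∀ t → Agree t → segRep c (dom t) ≡ dom t
  minimum-at t t-agree = trans (sym (t-agree (dom t) (n<1+n _))) (star-last t)
  same-dom : dom a ≡ dom b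
  same-dom with <-cmp (dom a) (dom b)
  ... | tri< a<b _ _ = ⊥-elim (no-minimum-beyond {a} {c} Va Vc a⊴c #a #c (dom b) a<b b≤c (minimum-at b b-agree))
  ... | tri≈ _ a≡b _ = a≡b
  ... | tri> _ _ b<a = ⊥-elim (no-minimum-beyond {b} {c} Vb Vc b⊴c #b #c (dom a) b<a a≤c (minimum-at a a-agree))
  same-rep : ∀ y → y < dom a → segRep a y ≡ segRep b y
  same-rep y y<a = begin
    segRep a y        ≡⟨ sym (star-agree a y y<a) ⟩
    segRep (star a) y ≡⟨ a-agree y (m<n⇒m<1+n y<a) ⟩
    segRep c y        ≡⟨ sym (b-agree y (m<n⇒m<1+n y<b)) ⟩
    segRep (star b) y ≡⟨ star-agree b y y<b ⟩
    segRep b y        ∎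
    where
    open ≡-Reasoning
    y<b : y < dom b
    y<b = subst (y <_) same-dom y<a

Step : (ℕ → Seg) → ℕ → Set
Step g i = ValidSeg (g (suc i)) × numBlocks (g (suc i)) ≡ suc i × star (g i) ⊴s g (suc i)

record History (k : ℕ) (g : ℕ → Seg) (t : Seg) : Set where
  field
    starts : g 0 ≡ emptySeg
    ends   : g k ≡ t
    steps  : ∀ i → i < k → Step g i
open History

history-valid : ∀ {k g t} → History k g t → ∀ i → i ≤ k → ValidSeg (g i) × numBlocks (g i) ≡ i
history-valid h zero    _   = subst (λ s → ValidSeg s × numBlocks s ≡ 0) (sym (starts h)) (emptySeg-valid , refl)
history-valid h (suc i) i<k = proj₁ (steps h i i<k) , proj₁ (proj₂ (steps h i i<k))

history-length : ∀ {k g t} → History k g t → numBlocks t ≡ k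
history-length {k} h = subst (λ s → numBlocks s ≡ k) (ends h) (proj₂ (history-valid h k ≤-refl))

-- By downward induction from g k ≡ t ≡ g′ k, using predecessor-unique at each step.
history-unique : ∀ {k g k′ g′ t} → History k g t → History k′ g′ t →
                 k ≡ k′ × (∀ i → i ≤ k → g i ≡ g′ i)
history-unique {k} {g} {k′} {g′} {t} h h′ = k≡k′ , λ i i≤k → agree-from (k ∸ i) i (m+[n∸m]≡n i≤k)
  where
  k≡k′ : k ≡ k′
  k≡k′ = trans (sym (history-length h)) (history-length h′)
  h″ : History k g′ t
  h″ = subst (λ z → History z g′ t) (sym k≡k′) h′
  agree-from : ∀ d i → i + d ≡ k → g i ≡ g′ i
  agree-from zero i i+0≡k with trans (sym (+-identityʳ i)) i+0≡k
  ... | refl = trans (ends h) (sym (ends h″))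
  agree-from (suc d) i i+1+d≡k =
    predecessor-unique {g i} {g′ i} {g (suc i)} (proj₁ (valid h)) (proj₁ (valid h″)) (proj₁ step)
      (proj₂ (proj₂ step)) (subst (star (g′ i) ⊴s_) (sym next) (proj₂ (proj₂ step′)))
      (proj₂ (valid h)) (proj₂ (valid h″)) (proj₁ (proj₂ step))
    where
    1+i+d≡k : suc i + d ≡ k
    1+i+d≡k = trans (sym (+-suc i d)) i+1+d≡k
    next : g (suc i) ≡ g′ (suc i)
    next = agree-from d (suc i) 1+i+d≡k
    i<k : i < k
    i<k = subst (suc i ≤_) 1+i+d≡k (m≤m+n (suc i) d)
    valid : ∀ {f} → History k f t → ValidSeg (f i) × numBlocks (f i) ≡ i
    valid hf = history-valid hf i (<⇒≤ i<k)
    step : Step g i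
    step = steps h i i<k
    step′ : Step g′ i
    step′ = steps h″ i i<k

mergeRep-cong : ∀ R R′ n {a a′} → R a ≡ R′ a′ → mergeRep R n a ≡ mergeRep R′ n a′
mergeRep-cong R R′ n e = cong (λ x → if x <ᵇ n then 0 else x) e

mergeRep-< : ∀ R {n} a → R a < n → mergeRep R n a ≡ 0
mergeRep-< R {n} a Ra<n with R a <ᵇ n | <⇒<ᵇ Ra<n
... | true | _ = refl

mergeRep-≥ : ∀ R {n} a → n ≤ R a → mergeRep R n a ≡ R a
mergeRep-≥ R {n} a n≤Ra with R a <ᵇ n in eq
... | true  = ⊥-elim (<⇒≱ (<ᵇ⇒< (R a) n (subst T (sym eq) _)) n≤Ra)
... | false = refl

mergeRep-0 : ∀ R n → R 0 ≡ 0 → mergeRep R n 0 ≡ 0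
mergeRep-0 R zero    R0≡0 = trans (mergeRep-≥ R 0 z≤n) R0≡0
mergeRep-0 R (suc n) R0≡0 = mergeRep-< R 0 (subst (_< suc n) (sym R0≡0) (s≤s z≤n))

mergeRep-1 : ∀ R a → mergeRep R 1 a ≡ R a
mergeRep-1 R a with R a
... | zero  = refl
... | suc _ = refl

mergeRep-≡⇒< : ∀ R {n x y} → R x < n → mergeRep R n x ≡ mergeRep R n y → R y < n
mergeRep-≡⇒< R {n} {x} {y} Rx<n e with R y <? n
... | yes Ry<n = Ry<n
... | no  Ry≮n = subst (_< n) (sym Ry≡0) (≤-<-trans z≤n Rx<n)
  where
  Ry≡0 : R y ≡ 0
  Ry≡0 = trans (sym (mergeRep-≥ R y (≮⇒≥ Ry≮n))) (trans (sym e) (mergeRep-< R x Rx<n))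

mergeRep-≡⇒ : ∀ R n {a b} → mergeRep R n a ≡ mergeRep R n b → R a ≡ R b ⊎ (R a < n × R b < n)
mergeRep-≡⇒ R n {a} {b} e with R a <? n | R b <? n
... | yes Ra<n | _        = inj₂ (Ra<n , mergeRep-≡⇒< R Ra<n e)
... | no  _    | yes Rb<n = inj₂ (mergeRep-≡⇒< R Rb<n (sym e) , Rb<n)
... | no  Ra≮n | no  Rb≮n =
  inj₁ (trans (sym (mergeRep-≥ R a (≮⇒≥ Ra≮n))) (trans e (mergeRep-≥ R b (≮⇒≥ Rb≮n))))

mergeRep-≼ : ∀ R n → mergeRep R n ≼ R
mergeRep-≼ R n a b = mergeRep-cong R R n

merge : Partition → ℕ → Partition
merge Z n = record
  { rep      = mergeRep (rep Z) n
  ; rep-≤    = λ a → merge-≤ a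
  ; rep-idem = λ a → merge-idem a
  }
  where
  Z0≡0 : rep Z 0 ≡ 0
  Z0≡0 = n≤0⇒n≡0 (rep-≤ Z 0)
  merge-≤ : ∀ a → mergeRep (rep Z) n a ≤ a
  merge-≤ a with rep Z a <ᵇ n
  ... | true  = z≤n
  ... | false = rep-≤ Z a
  merge-idem : ∀ a → mergeRep (rep Z) n (mergeRep (rep Z) n a) ≡ mergeRep (rep Z) n a
  merge-idem a with rep Z a <ᵇ n in eq
  ... | true  = mergeRep-0 (rep Z) n Z0≡0
  ... | false rewrite rep-idem Z a | eq = refl

rep-⊑ : ∀ {Z Z′} → Z ⊑ Z′ → ∀ a → rep Z a ≤ rep Z′ a
rep-⊑ {Z} {Z′} Z⊑Z′ a = subst (_≤ rep Z′ a) (Z⊑Z′ (rep Z′ a) a (rep-idem Z′ a)) (rep-≤ Z (rep Z′ a))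

mergeRep-mono : ∀ {Z Z′} n → Z ⊑ Z′ → mergeRep (rep Z) n ≼ mergeRep (rep Z′) n
mergeRep-mono {Z} {Z′} n Z⊑Z′ a b e with mergeRep-≡⇒ (rep Z′) n e
... | inj₁ Z′a≡Z′b          = mergeRep-cong (rep Z) (rep Z) n (Z⊑Z′ a b Z′a≡Z′b)
... | inj₂ (Z′a<n , Z′b<n) = trans (mergeRep-< (rep Z) a (≤-<-trans (rep-⊑ {Z} {Z′} Z⊑Z′ a) Z′a<n))
                                  (sym (mergeRep-< (rep Z) b (≤-<-trans (rep-⊑ {Z} {Z′} Z⊑Z′ b) Z′b<n)))

IsLeast : (ℕ → Set) → ℕ → Set
IsLeast P r = P r × (∀ i → i < r → ¬ P i)

IsLeast-unique : ∀ {P r r′} → IsLeast P r → IsLeast P r′ → r ≡ r′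
IsLeast-unique {r = r} {r′} (Pr , below-r) (Pr′ , below-r′) with <-cmp r r′
... | tri< r<r′ _ _ = ⊥-elim (below-r′ r r<r′ Pr)
... | tri≈ _ r≡r′ _ = r≡r′
... | tri> _ _ r′<r = ⊥-elim (below-r r′ r′<r Pr′)

least-below : ∀ {P} → Decidable P → ∀ n → (Σ[ r ∈ ℕ ] r < n × IsLeast P r) ⊎ (∀ i → i < n → ¬ P i)
least-below P? zero = inj₂ (λ i ())
least-below P? (suc n) with least-below P? n
... | inj₁ (r , r<n , least) = inj₁ (r , m<n⇒m<1+n r<n , least)
... | inj₂ none with P? n
...   | yes Pn = inj₁ (n , n<1+n n , Pn , none)
...   | no ¬Pn = inj₂ λ i i<1+n → [ none i , (λ { refl → ¬Pn }) ]′ (m<1+n⇒m<n∨m≡n i<1+n)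

least-exists : ∀ {P} → Decidable P → ∀ {n} → P n → Σ[ r ∈ ℕ ] IsLeast P r × r ≤ n
least-exists P? {n} Pn with least-below P? (suc n)
... | inj₁ (r , r<1+n , least) = r , least , ≤-pred r<1+n
... | inj₂ none = ⊥-elim (none n (n<1+n n) Pn)

data Linked (X Y : Partition) : ℕ → ℕ → Set where
  done  : ∀ {a} → Linked X Y a a
  via-X : ∀ {a b c} → Same X a b → Linked X Y b c → Linked X Y a c
  via-Y : ∀ {a b c} → Same Y a b → Linked X Y b c → Linked X Y a c

module _ {X Y : Partition} where

  Linked-trans : ∀ {a b c} → Linked X Y a b → Linked X Y b c → Linked X Y a c
  Linked-trans done        q = q
  Linked-trans (via-X e p) q = via-X e (Linked-trans p q)
  Linked-trans (via-Y e p) q = via-Y e (Linked-trans p q)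

  Linked-sym : ∀ {a b} → Linked X Y a b → Linked X Y b a
  Linked-sym done        = done
  Linked-sym (via-X e p) = Linked-trans (Linked-sym p) (via-X (sym e) done)
  Linked-sym (via-Y e p) = Linked-trans (Linked-sym p) (via-Y (sym e) done)

  Linked-⊑ : ∀ W → W ⊑ X → W ⊑ Y → ∀ {a b} → Linked X Y a b → Same W a b
  Linked-⊑ W W⊑X W⊑Y done        = refl
  Linked-⊑ W W⊑X W⊑Y (via-X e p) = trans (W⊑X _ _ e) (Linked-⊑ W W⊑X W⊑Y p)
  Linked-⊑ W W⊑X W⊑Y (via-Y e p) = trans (W⊑Y _ _ e) (Linked-⊑ W W⊑X W⊑Y p)

module Meet (lem : ExcludedMiddle 0ℓ) (X Y : Partition) where

  least-linked : ∀ a → Σ[ r ∈ ℕ ] IsLeast (Linked X Y a) r × r ≤ a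
  least-linked a = least-exists (λ _ → lem) done

  meetRep : ℕ → ℕ
  meetRep a = proj₁ (least-linked a)

  meetRep-least : ∀ a → IsLeast (Linked X Y a) (meetRep a)
  meetRep-least a = proj₁ (proj₂ (least-linked a))

  meetRep-cong : ∀ {a b} → Linked X Y a b → meetRep a ≡ meetRep b
  meetRep-cong {a} {b} ab = IsLeast-unique
    (Linked-trans (Linked-sym ab) (proj₁ (meetRep-least a)) ,
     λ i i<r bi → proj₂ (meetRep-least a) i i<r (Linked-trans ab bi))
    (meetRep-least b)

  meetRep-linked : ∀ {a b} → meetRep a ≡ meetRep b → Linked X Y a b
  meetRep-linked {a} {b} e =
    Linked-trans (subst (Linked X Y a) e (proj₁ (meetRep-least a))) (Linked-sym (proj₁ (meetRep-least b)))

  meet : Partition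
  meet = record
    { rep      = meetRep
    ; rep-≤    = λ a → proj₂ (proj₂ (least-linked a))
    ; rep-idem = λ a → meetRep-cong (Linked-sym (proj₁ (meetRep-least a)))
    }

  meet-IsMeet : IsMeet X Y meet
  meet-IsMeet = (λ a b e → meetRep-cong (via-X e done)) ,
                (λ a b e → meetRep-cong (via-Y e done)) ,
                λ W W⊑X W⊑Y a b e → Linked-⊑ W W⊑X W⊑Y (meetRep-linked e)

module Ultrafilter (lem : ExcludedMiddle 0ℓ) (U : Partition → Set) (U-infinite : ∀ X → U X → Infinite X)
                   (U-ultra : IsPUltrafilter U) where

  open Meet lem using (meet; meet-IsMeet)

  U-meet : ∀ {X Y} → U X → U Y → U (meet X Y)
  U-meet {X} {Y} UX UY = proj₁ (proj₂ (proj₁ U-ultra)) X Y (meet X Y) UX UY (meet-IsMeet X Y)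

  U-⊑ : ∀ {X Y} → U X → X ⊑ Y → U Y
  U-⊑ {X} {Y} = proj₂ (proj₂ (proj₁ U-ultra)) X Y

  -- {Y : Z ⊓ {n} ⊑ Y for some Z ∈ U} is a partition-filter containing U, hence equal to U.
  U-⊑* : ∀ {Z X} n → U Z → mergeRep (rep Z) n ≼ rep X → U X
  U-⊑* {Z} {X} n UZ Z⊓n⊑X =
    proj₂ U-ultra Merged (Merged-proper , Merged-meet , Merged-⊑)
      (λ Y UY → Y , UY , mergeRep-≼ (rep Y) n) X (Z , UZ , Z⊓n⊑X)
    where
    Merged : Partition → Set
    Merged Y = Σ[ Z ∈ Partition ] U Z × merge Z n ⊑ Y

    -- Z ∈ U has a block minimum c > n, which stays apart from the merged block of 0.
    Merged-proper : ∀ Y → Merged Y → ¬ IsOneBlock Y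
    Merged-proper Y (Z , UZ , Z⊓n⊑Y) one-block = 1+n≰n (subst (1 ≤_) c≡0 (≤-trans (s≤s z≤n) n<c))
      where
      c : ℕ
      c = proj₁ (U-infinite Z UZ (suc n))
      n<c : n < c
      n<c = proj₁ (proj₂ (U-infinite Z UZ (suc n)))
      Zc≡c : rep Z c ≡ c
      Zc≡c = proj₂ (proj₂ (U-infinite Z UZ (suc n)))
      c≡0 : c ≡ 0
      c≡0 = begin
        c                    ≡⟨ sym Zc≡c ⟩
        rep Z c              ≡⟨ sym (mergeRep-≥ (rep Z) c (≤-trans (<⇒≤ n<c) (≤-reflexive (sym Zc≡c)))) ⟩
        mergeRep (rep Z) n c ≡⟨ Z⊓n⊑Y c 0 (one-block c 0) ⟩
        mergeRep (rep Z) n 0 ≡⟨ mergeRep-0 (rep Z) n (n≤0⇒n≡0 (rep-≤ Z 0)) ⟩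
        0                    ∎
        where open ≡-Reasoning

    Merged-meet : ∀ X Y W → Merged X → Merged Y → IsMeet X Y W → Merged W
    Merged-meet X Y W (Z₁ , UZ₁ , Z₁⊑X) (Z₂ , UZ₂ , Z₂⊑Y) (_ , _ , W-greatest) =
      meet Z₁ Z₂ , U-meet UZ₁ UZ₂ ,
      W-greatest (merge (meet Z₁ Z₂) n)
        (λ a b e → mergeRep-mono {meet Z₁ Z₂} {Z₁} n (proj₁ (meet-IsMeet Z₁ Z₂)) a b (Z₁⊑X a b e))
        (λ a b e → mergeRep-mono {meet Z₁ Z₂} {Z₂} n (proj₁ (proj₂ (meet-IsMeet Z₁ Z₂))) a b (Z₂⊑Y a b e))

    Merged-⊑ : ∀ X Y → Merged X → X ⊑ Y → Merged Y
    Merged-⊑ X Y (Z , UZ , Z⊑X) X⊑Y = Z , UZ , λ a b e → Z⊑X a b (X⊑Y a b e)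

  U-lower-bound : ∀ Y Ys → (∀ Z → Z ∈ Y ∷ Ys → U Z) →
                  Σ[ M ∈ Partition ] U M × (∀ Z → Z ∈ Y ∷ Ys → M ⊑ Z)
  U-lower-bound Y []         UYs = Y , UYs Y (here refl) , λ { _ (here refl) a b e → e }
  U-lower-bound Y (Y′ ∷ Ys) UYs with U-lower-bound Y′ Ys (λ Z Z∈ → UYs Z (there Z∈))
  ... | M , UM , M⊑Ys = meet Y M , U-meet (UYs Y (here refl)) UM , lower
    where
    lower : ∀ Z → Z ∈ Y ∷ Y′ ∷ Ys → meet Y M ⊑ Z
    lower Z (here refl) = proj₁ (meet-IsMeet Y M)
    lower Z (there Z∈)  = λ a b e → proj₁ (proj₂ (meet-IsMeet Y M)) a b (M⊑Ys Z Z∈ a b e)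

  Fil⊆U : ∀ Xf → (∀ t → U (Xf t)) → ∀ X → Fil Xf X → U X
  Fil⊆U Xf U-Xf X ([]     , []≢[] , _) = ⊥-elim ([]≢[] refl)
  Fil⊆U Xf U-Xf X (t ∷ ts , _ , _ , Z , (_ , Z-greatest) , n , Z⊓n⊑X)
    with U-lower-bound (Xf t) (map Xf ts) U-Xfs
    where
    U-Xfs : ∀ Y → Y ∈ map Xf (t ∷ ts) → U Y
    U-Xfs Y Y∈ with ∈-map⁻ Xf Y∈
    ... | s , _ , refl = U-Xf s
  ... | M , UM , M⊑Xfs = U-⊑* {Z} n (U-⊑ {M} {Z} UM (Z-greatest M M⊑Xfs)) Z⊓n⊑X

lastSeg : ∀ {k} → Vec Seg k → Seg
lastSeg []          = emptySeg
lastSeg (x ∷ [])    = x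
lastSeg (x ∷ y ∷ v) = lastSeg (y ∷ v)

lastSeg-tabulate : ∀ k (f : ℕ → Seg) → lastSeg (tabulate {n = suc k} (λ i → f (toℕ i))) ≡ f k
lastSeg-tabulate zero    f = refl
lastSeg-tabulate (suc k) f = lastSeg-tabulate k (f ∘ suc)

lastSeg-prefix : ∀ s → s 0 ≡ emptySeg → ∀ m → lastSeg (prefix s m) ≡ s m
lastSeg-prefix s s0≡∅ zero    = sym s0≡∅
lastSeg-prefix s s0≡∅ (suc m) = lastSeg-tabulate m (s ∘ suc)

module LegalPlay (σ : Strategy) (s : ℕ → Seg) (s0≡∅ : s 0 ≡ emptySeg) (legal : ∀ k → LegalII σ s k)
                 (X : Partition) (s⊴X : ∀ n → s n ⊴ω X) where

  play-step : ∀ k → Step s k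
  play-step k = proj₁ (legal k) , proj₁ (proj₂ (legal k)) , proj₁ (proj₂ (proj₂ (legal k)))

  play-history : ∀ k → History k s (s k)
  play-history k = record { starts = s0≡∅ ; ends = refl ; steps = λ i _ → play-step i }

  play-valid : ∀ k → ValidSeg (s k) × numBlocks (s k) ≡ k
  play-valid k = history-valid (play-history k) k ≤-refl

  play-agree : ∀ n a → a < dom (s n) → segRep (s n) a ≡ rep X a
  play-agree n = SegTri⇒agree (proj₁ (play-valid n)) (rep-RepBelow X _) (s⊴X n)

  play-dom-≥ : ∀ k → k ≤ dom (s k)
  play-dom-≥ zero    = z≤n
  play-dom-≥ (suc k) = ≤-trans (s≤s (play-dom-≥ k)) (proj₁ (proj₂ (proj₂ (play-step k))))

  minimum-below⇒dom : ∀ k c → c < dom (s k) → rep X c ≡ c → Σ[ n ∈ ℕ ] dom (s n) ≡ c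
  minimum-below⇒dom zero c c<s0 _ = ⊥-elim (n≮0 (subst (c <_) (cong dom s0≡∅) c<s0))
  minimum-below⇒dom (suc k) c c<sk+1 Xc≡c with <-cmp c (dom (s k))
  ... | tri< c<sk _ _ = minimum-below⇒dom k c c<sk Xc≡c
  ... | tri≈ _ c≡sk _ = k , sym c≡sk
  ... | tri> _ _ sk<c = ⊥-elim (no-minimum-beyond {s k} {s (suc k)}
                          (proj₁ (play-valid k)) (proj₁ (play-valid (suc k))) (proj₂ (proj₂ (play-step k)))
                          (proj₂ (play-valid k)) (proj₂ (play-valid (suc k))) c sk<c c<sk+1
                          (trans (play-agree (suc k) c c<sk+1) Xc≡c))

  minimum⇒dom : ∀ c → rep X c ≡ c → Σ[ n ∈ ℕ ] dom (s n) ≡ c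
  minimum⇒dom c = minimum-below⇒dom (suc c) c (play-dom-≥ (suc c))

  star⊴⇒played : ∀ t → ValidSeg t → star t ⊴ω X → Σ[ n ∈ ℕ ] s n ≡ t
  star⊴⇒played t t-valid t*⊴X with minimum⇒dom (dom t) X-last
    where
    X-last : rep X (dom t) ≡ dom t
    X-last = trans (sym (star⊴ω⇒agree t {X} t-valid t*⊴X (dom t) (n<1+n _))) (star-last t)
  ... | n , sn≡t = n , seg-ext (s n) t sn≡t same-rep
    where
    same-rep : ∀ a → a < dom (s n) → segRep (s n) a ≡ segRep t a
    same-rep a a<sn = begin
      segRep (s n) a    ≡⟨ play-agree n a a<sn ⟩
      rep X a           ≡⟨ sym (star⊴ω⇒agree t {X} t-valid t*⊴X a (m<n⇒m<1+n a<t)) ⟩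
      segRep (star t) a ≡⟨ star-agree t a a<t ⟩
      segRep t a        ∎
      where
      open ≡-Reasoning
      a<t : a < dom t
      a<t = subst (a <_) sn≡t a<sn

  -- Apply legality at a round k so late that a, b < dom (s (k + 1)), where s (k + 1) agrees with X.
  merge⊑move : ∀ n → mergeRep (rep X) (dom (s n) + 1) ≼ rep (moveI σ s n)
  merge⊑move n a b e = begin
    mergeRep (rep X) m a                      ≡⟨ sym (star-agrees a a<D) ⟩
    mergeRep (segRep (star (s (suc k)))) m a  ≡⟨ legal-k a b (<-≤-trans a<D D≤D+1) (<-≤-trans b<D D≤D+1) e ⟩
    mergeRep (segRep (star (s (suc k)))) m b  ≡⟨ star-agrees b b<D ⟩
    mergeRep (rep X) m b                      ∎
    where
    open ≡-Reasoning
    m k D : ℕ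
    m = dom (s n) + 1
    k = n + (a + b)
    D = dom (s (suc k))
    D≤D+1 : D ≤ D + 1
    D≤D+1 = m≤m+n D 1
    legal-k : SegLE (D + 1) (mergeRep (segRep (star (s (suc k)))) m) (rep (moveI σ s n))
    legal-k = proj₂ (proj₂ (proj₂ (legal k))) n (s≤s (m≤m+n n (a + b)))
    k<D : suc k ≤ D
    k<D = play-dom-≥ (suc k)
    a<D : a < D
    a<D = ≤-<-trans (≤-trans (m≤m+n a b) (m≤n+m (a + b) n)) k<D
    b<D : b < D
    b<D = ≤-<-trans (≤-trans (m≤n+m b a) (m≤n+m (a + b) n)) k<D
    star-agrees : ∀ x → x < D → mergeRep (segRep (star (s (suc k)))) m x ≡ mergeRep (rep X) m x
    star-agrees x x<D = mergeRep-cong (segRep (star (s (suc k)))) (rep X) m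
                          (trans (star-agree (s (suc k)) x x<D) (play-agree (suc k) x x<D))

module Cuts (X : Partition) (X-infinite : Infinite X) where

  next-minimum : ∀ j → Σ[ r ∈ ℕ ] IsLeast (λ n → j < n × rep X n ≡ n) r × r ≤ proj₁ (X-infinite (suc j))
  next-minimum j = least-exists (λ n → (j <? n) ×-dec (rep X n ≟ n))
                     (proj₁ (proj₂ (X-infinite (suc j))) , proj₂ (proj₂ (X-infinite (suc j))))

  minimumAt : ℕ → ℕ
  minimumAt zero    = 0
  minimumAt (suc k) = proj₁ (next-minimum (minimumAt k))

  minimumAt-minimum : ∀ k → rep X (minimumAt k) ≡ minimumAt k
  minimumAt-minimum zero    = n≤0⇒n≡0 (rep-≤ X 0)
  minimumAt-minimum (suc k) = proj₂ (proj₁ (proj₁ (proj₂ (next-minimum (minimumAt k)))))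

  minimumAt-< : ∀ k → minimumAt k < minimumAt (suc k)
  minimumAt-< k = proj₁ (proj₁ (proj₁ (proj₂ (next-minimum (minimumAt k)))))

  minimumAt-gap : ∀ k x → minimumAt k < x → x < minimumAt (suc k) → rep X x ≢ x
  minimumAt-gap k x k<x x<k+1 Xx≡x =
    proj₂ (proj₁ (proj₂ (next-minimum (minimumAt k)))) x x<k+1 (k<x , Xx≡x)

  countMinima-minimumAt : ∀ k → countMinima (rep X) (minimumAt k) ≡ k
  countMinima-minimumAt zero    = refl
  countMinima-minimumAt (suc k) = begin
    countMinima (rep X) (minimumAt (suc k))  ≡⟨ cong (countMinima (rep X)) (sym gap+lo≡k+1) ⟩
    countMinima (rep X) (gap + lo)           ≡⟨ countMinima-no-minima (rep X) lo gap none ⟩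
    countMinima (rep X) lo                   ≡⟨ countMinima-suc-minimum (rep X) (minimumAt k) (minimumAt-minimum k) ⟩
    suc (countMinima (rep X) (minimumAt k))  ≡⟨ cong suc (countMinima-minimumAt k) ⟩
    suc k                                    ∎
    where
    open ≡-Reasoning
    lo gap : ℕ
    lo = suc (minimumAt k)
    gap = minimumAt (suc k) ∸ lo
    gap+lo≡k+1 : gap + lo ≡ minimumAt (suc k)
    gap+lo≡k+1 = m∸n+n≡m (minimumAt-< k)
    none : ∀ x → lo ≤ x → x < gap + lo → rep X x ≢ x
    none x lo≤x x<gap+lo = minimumAt-gap k x lo≤x (subst (x <_) gap+lo≡k+1 x<gap+lo)

  cut : ℕ → Seg
  cut k = minimumAt k , tabulate (λ i → rep X (toℕ i))

  cut-agree : ∀ k a → a < minimumAt k → segRep (cut k) a ≡ rep X a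
  cut-agree k = nth-tabulate (minimumAt k) (rep X)

  cut-valid : ∀ k → ValidSeg (cut k)
  cut-valid k = agree⇒RepBelow (rep X) (rep-RepBelow X _) (cut-agree k)

  cut-numBlocks : ∀ k → numBlocks (cut k) ≡ k
  cut-numBlocks k = trans (countMinima-cong _ (rep X) (minimumAt k) (cut-agree k)) (countMinima-minimumAt k)

  star-cut-agree : ∀ k a → a < suc (minimumAt k) → segRep (star (cut k)) a ≡ rep X a
  star-cut-agree k = star-agree-with (cut k) (rep X) (cut-agree k) (minimumAt-minimum k)

  cut-⊴ω : ∀ k → cut k ⊴ω X
  cut-⊴ω k = agree⇒SegTri (rep X) (cut-agree k) (λ _ _ → refl)

  star-cut-⊴ω : ∀ k → star (cut k) ⊴ω X
  star-cut-⊴ω k = agree⇒SegTri (rep X) (star-cut-agree k) (λ _ _ → refl)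

  cut-step : ∀ k → Step cut k
  cut-step k = cut-valid (suc k) , cut-numBlocks (suc k) ,
               (minimumAt-< k , agree⇒SegTri (rep X) (star-cut-agree k)
                                  (λ a a<k → cut-agree (suc k) a (<-≤-trans a<k (minimumAt-< k))))

  cut-history : ∀ k → History k cut (cut k)
  cut-history k = record { starts = refl ; ends = refl ; steps = λ i _ → cut-step i }

¬Π⇒Σ¬ : ExcludedMiddle 0ℓ → {A : Set} {B : A → Set} → ¬ ((x : A) → B x) → Σ[ x ∈ A ] ¬ B x
¬Π⇒Σ¬ lem {A} {B} ¬Π with lem {Σ[ x ∈ A ] ¬ B x}
... | yes Σ¬ = Σ¬
... | no ¬Σ¬ = ⊥-elim (¬Π λ x → Bx x)
  where
  Bx : ∀ x → B x
  Bx x with lem {B x}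
  ... | yes b = b
  ... | no ¬b = ⊥-elim (¬Σ¬ (x , ¬b))

module DiagonalizerFree (lem : ExcludedMiddle 0ℓ) (U : Partition → Set) (Xf : Seg → Partition)
                        (Fil⊆U : ∀ X → Fil Xf X → U X)
                        (no-diagonalizer : ¬ (Σ[ X ∈ Partition ] U X × Diagonalizes X Xf)) where

  Xf∈Fil : ∀ t → ValidSeg t → Fil Xf (Xf t)
  Xf∈Fil t t-valid =
    t ∷ [] , (λ ()) , (λ { _ (here refl) → t-valid }) ,
    Xf t , ((λ { _ (here refl) a b e → e }) , (λ W W⊑ → W⊑ (Xf t) (here refl))) , 0 , λ a b e → e

  Xf-U : ∀ t → ValidSeg t → U (Xf t)
  Xf-U t t-valid = Fil⊆U (Xf t) (Xf∈Fil t t-valid)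

  -- Invalid segments never occur in a legal play; the default keeps every move in U.
  move : Seg → Partition
  move t with lem {ValidSeg t}
  ... | yes _ = Xf t
  ... | no  _ = Xf emptySeg

  move-valid : ∀ t → ValidSeg t → move t ≡ Xf t
  move-valid t t-valid with lem {ValidSeg t}
  ... | yes _ = refl
  ... | no  t-invalid = ⊥-elim (t-invalid t-valid)

  move-U : ∀ t → U (move t)
  move-U t with lem {ValidSeg t}
  ... | yes t-valid = Xf-U t t-valid
  ... | no  _       = Xf-U emptySeg emptySeg-valid

  σ : Strategy
  σ k h = move (lastSeg h)

  outcome-diagonalizes : ∀ s → s 0 ≡ emptySeg → (∀ k → LegalII σ s k) →
                         ∀ X → (∀ n → s n ⊴ω X) → Diagonalizes X Xf
  outcome-diagonalizes s s0≡∅ legal X s⊴X = X⊑Xf∅ , X⊑*Xf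
    where
    open LegalPlay σ s s0≡∅ legal X s⊴X
    merge⊑Xf : ∀ n → mergeRep (rep X) (dom (s n) + 1) ≼ rep (Xf (s n))
    merge⊑Xf n a b e = merge⊑move n a b (subst (λ P → rep P a ≡ rep P b) (sym σ-move) e)
      where
      σ-move : moveI σ s n ≡ Xf (s n)
      σ-move = trans (cong move (lastSeg-prefix s s0≡∅ n)) (move-valid (s n) (proj₁ (play-valid n)))
    X⊑Xf∅ : X ⊑ Xf emptySeg
    X⊑Xf∅ a b e = begin
      rep X a              ≡⟨ sym (mergeRep-1 (rep X) a) ⟩
      mergeRep (rep X) 1 a ≡⟨ merge⊑Xf∅ a b e ⟩
      mergeRep (rep X) 1 b ≡⟨ mergeRep-1 (rep X) b ⟩
      rep X b              ∎
      where
      open ≡-Reasoning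
      merge⊑Xf∅ : mergeRep (rep X) 1 ≼ rep (Xf emptySeg)
      merge⊑Xf∅ = subst (λ t → mergeRep (rep X) (dom t + 1) ≼ rep (Xf t)) s0≡∅ (merge⊑Xf 0)
    X⊑*Xf : ∀ t → ValidSeg t → star t ⊴ω X → mergeRep (rep X) (dom t + 1) ≼ rep (Xf t)
    X⊑*Xf t t-valid t*⊴X with star⊴⇒played t t-valid t*⊴X
    ... | n , refl = merge⊑Xf n

  σ-wins : IWins U
  σ-wins = σ , (λ k h → move-U (lastSeg h)) ,
           λ s s0≡∅ legal X s⊴X UX → no-diagonalizer (X , UX , outcome-diagonalizes s s0≡∅ legal X s⊴X)

module WinningStrategy (lem : ExcludedMiddle 0ℓ) (U : Partition → Set) (U-infinite : ∀ X → U X → Infinite X)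
                       (U-ultra : IsPUltrafilter U) (σ : Strategy) (σ-U : ∀ k h → U (σ k h))
                       (σ-wins : ∀ s → s 0 ≡ emptySeg → (∀ k → LegalII σ s k) →
                                 ∀ X → (∀ n → s n ⊴ω X) → ¬ U X) where

  open Ultrafilter lem U U-infinite U-ultra using (Fil⊆U)

  HasHistory : Seg → Set
  HasHistory t = Σ[ k ∈ ℕ ] Σ[ g ∈ (ℕ → Seg) ] History k g t

  -- σ's answer at the (unique) position ending in t.
  Xf : Seg → Partition
  Xf t with lem {HasHistory t}
  ... | yes (k , g , _) = σ k (prefix g k)
  ... | no  _           = σ 0 []

  Xf-U : ∀ t → U (Xf t)
  Xf-U t with lem {HasHistory t}
  ... | yes (k , g , _) = σ-U k (prefix g k)
  ... | no  _           = σ-U 0 []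

  Xf-history : ∀ {k g t} → History k g t → Xf t ≡ σ k (prefix g k)
  Xf-history {k} {g} {t} h with lem {HasHistory t}
  ... | no  no-history = ⊥-elim (no-history (k , g , h))
  ... | yes (k′ , g′ , h′) with history-unique h′ h
  ...   | refl , g′≡g = cong (σ k′) (tabulate-cong (λ i → g′≡g (suc (toℕ i)) (toℕ<n i)))

  diagonalizer∉U : ∀ X → Diagonalizes X Xf → ¬ U X
  diagonalizer∉U X (_ , X⊑*Xf) UX = σ-wins cut refl legal X cut-⊴ω UX
    where
    open Cuts X (U-infinite X UX)
    legal : ∀ k → LegalII σ cut k
    legal k = proj₁ (cut-step k) , proj₁ (proj₂ (cut-step k)) , proj₂ (proj₂ (cut-step k)) , merge⊑move
      where
      D : ℕ
      D = minimumAt (suc k)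
      star-agrees : ∀ m x → x < D + 1 →
                    mergeRep (segRep (star (cut (suc k)))) m x ≡ mergeRep (rep X) m x
      star-agrees m x x<D+1 = mergeRep-cong (segRep (star (cut (suc k)))) (rep X) m
                                (star-cut-agree (suc k) x (subst (x <_) (+-comm D 1) x<D+1))
      merge⊑move : ∀ m → m < suc k →
                   SegLE (D + 1) (mergeRep (segRep (star (cut (suc k)))) (minimumAt m + 1)) (rep (moveI σ cut m))
      merge⊑move m _ a b a< b< e = begin
        mergeRep (segRep (star (cut (suc k)))) (minimumAt m + 1) a ≡⟨ star-agrees (minimumAt m + 1) a a< ⟩
        mergeRep (rep X) (minimumAt m + 1) a                      ≡⟨ X⊑*Xf (cut m) (cut-valid m) (star-cut-⊴ω m) a b e′ ⟩
        mergeRep (rep X) (minimumAt m + 1) b                      ≡⟨ sym (star-agrees (minimumAt m + 1) b b<) ⟩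
        mergeRep (segRep (star (cut (suc k)))) (minimumAt m + 1) b ∎
        where
        open ≡-Reasoning
        e′ : rep (Xf (cut m)) a ≡ rep (Xf (cut m)) b
        e′ = subst (λ P → rep P a ≡ rep P b) (sym (Xf-history (cut-history m))) e

  not-happy : ¬ RelHappy U
  not-happy happy with happy Xf (Fil⊆U Xf Xf-U)
  ... | X , UX , X-diag = diagonalizer∉U X X-diag UX

theorem3p2 : ExcludedMiddle 0ℓ → (U : Partition → Set) → (∀ X → U X → Infinite X) →
    IsPUltrafilter U → IWins U ⇔ (¬ RelHappy U)
theorem3p2 lem U U-infinite U-ultra = mk⇔ IWins⇒¬RelHappy ¬RelHappy⇒IWins
  where
  IWins⇒¬RelHappy : IWins U → ¬ RelHappy U
  IWins⇒¬RelHappy (σ , σ-U , σ-wins) = WinningStrategy.not-happy lem U U-infinite U-ultra σ σ-U σ-wins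

  ¬RelHappy⇒IWins : ¬ RelHappy U → IWins U
  ¬RelHappy⇒IWins ¬happy with ¬Π⇒Σ¬ lem ¬happy
  ... | Xf , ¬diagonalizable with ¬Π⇒Σ¬ lem ¬diagonalizable
  ...   | Fil⊆U , no-diagonalizer = DiagonalizerFree.σ-wins lem U Xf Fil⊆U no-diagonalizer
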